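{- If $f\in x+x^2\mathbb{C}[[x]]$ satisfies $\mathfrak{T}^2f(x)=\dfrac{f(2x)}{2}$, then $f(-x)=-f(x)$.
   Context: $x+x^2\mathbb{C}[[x]]$ is the set of formal power series with zero constant term and linear coefficient 1; for $f$ in this set, $\mathfrak{T}f:=f/f'$ and $\mathfrak{T}^2=\mathfrak{T}\circ\mathfrak{T}$. -}

module Defs where

open import Level using (Level; _⊔_) renaming (suc to lsuc)
open import Data.Nat using (ℕ; zero; suc)
open import Data.List using (List; []; _∷_)
open import Data.Product using (Σ; _,_; proj₁)
import Data.Product as Prod
open import Relation.Nullary using (¬_)
open import Algebra.Bundles using (CommutativeRing; Semiring)
import Algebra.Definitions.RawSemiring as RS

record Field (c ℓ : Level) : Set (lsuc (c ⊔ ℓ)) where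
  field
    commutativeRing : CommutativeRing c ℓ
  open CommutativeRing commutativeRing public
  field
    0≉1     : ¬ (0# ≈ 1#)
    inverse : (x : Carrier) → ¬ (x ≈ 0#) → Σ Carrier (λ y → x * y ≈ 1#)
  open RS (Semiring.rawSemiring semiring) public using (_×_; _^_)

CharZero : ∀ {c ℓ} → Field c ℓ → Set ℓ
CharZero K = (n : ℕ) → ¬ (suc n × 1# ≈ 0#)
  where open Field K

module PowerSeries {c ℓ} (K : Field c ℓ) where
  open Field K

  Series : Set c
  Series = ℕ → Carrier

  _≋_ : Series → Series → Set ℓ
  f ≋ g = (n : ℕ) → f n ≈ g n

  InX+X² : Series → Set ℓ
  InX+X² f = Prod.Σ (f 0 ≈ 0#) (λ _ → f 1 ≈ 1#)

  deriv : Series → Series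
  deriv f n = suc n × f (suc n)

  -- Quotient f / d for a series d with constant term 1:
  -- g is the unique series with g · d = f, i.e.
  -- gₙ = fₙ − Σ_{k=0}^{n−1} d_{n−k} g_k.
  -- `hist n` is the list [g_{n−1}, …, g_0].
  module Quot (f d : Series) where
    conv : ℕ → List Carrier → Carrier
    conv j []       = 0#
    conv j (x ∷ xs) = d (suc j) * x + conv (suc j) xs

    next : ℕ → List Carrier → Carrier
    next n prev = f n - conv 0 prev

    hist : ℕ → List Carrier
    hist zero    = []
    hist (suc n) = next n (hist n) ∷ hist n

    quot : Series
    quot n = next n (hist n)

  -- f / d  (meaningful when d 0 ≈ 1#)
  _/ₛ_ : Series → Series → Series
  f /ₛ d = Quot.quot f d

  -- The operator 𝔗 f = f / f'  (for f ∈ x + x² K[[x]], f' has constant term 1)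
  𝔗 : Series → Series
  𝔗 f = f /ₛ deriv f

  negArg : Series → Series
  negArg f n = ((- 1#) ^ n) * f n

  negS : Series → Series
  negS f n = - f n

  halfDouble : CharZero K → Series → Series
  halfDouble ch f n = proj₁ (inverse (2 × 1#) (ch 1)) * (((2 × 1#) ^ n) * f n)

module Submission where

-- Write g = 𝔗f and h = 𝔗g.  Suppose the even coefficients of f below an even
-- degree n ≥ 2 vanish.  Then so do those of g and h, and comparing degree-n
-- coefficients in g·f' = f and h·g' = g gives  gₙ = (1 − n)fₙ  and
-- hₙ = (1 − n)gₙ, while the hypothesis gives 2hₙ = 2ⁿfₙ.  Hence
-- 2(n − 1)²fₙ = 2ⁿfₙ, and since 2ⁿ ≠ 2(n − 1)² for even n ≥ 2 (the two sides
-- differ modulo 4), characteristic zero forces fₙ = 0.  Induction on n shows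
-- that all even coefficients vanish, which is exactly f(−x) = −f(x).

open import Defs
open import Level using (Level)
open import Algebra.Bundles using (CommutativeMonoid; Semiring; Ring)
open import Data.Bool using (Bool; true; false; not; _xor_; if_then_else_)
open import Data.Bool.Properties using (not-involutive; not-distribˡ-xor)
import Data.Nat as Nat
open Nat using (ℕ; zero; suc; _<_; _≤_; s≤s; z≤n)
import Data.Nat.Properties as NatProp
open NatProp
  using (suc-injective; +-suc; +-monoʳ-≤; m<m+n; ≤-<-trans;
         <-cmp; m≤n⇒∃[o]m+o≡n; m<1+n⇒m<n∨m≡n; n<1+n; m<n⇒m<1+n; ≤-refl; <⇒≤)
open import Data.Nat.Tactic.RingSolver using (solve-∀)
open import Data.Product using (Σ; _,_; proj₁; proj₂)
open import Data.Sum using (inj₁; inj₂)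
open import Relation.Binary using (tri<; tri≈; tri>)
import Relation.Binary.PropositionalEquality as ≡
open ≡ using (_≡_; _≢_)
open import Relation.Nullary using (contradiction)

module Parity where
  open Nat using (_+_)

  odd : ℕ → Bool
  odd zero    = false
  odd (suc n) = not (odd n)

  Even : ℕ → Set
  Even n = odd n ≡ false

  odd-+ : ∀ m n → odd (m + n) ≡ odd m xor odd n
  odd-+ zero    n = ≡.refl
  odd-+ (suc m) n = ≡.trans (≡.cong not (odd-+ m n)) (not-distribˡ-xor (odd m) (odd n))

  even-2+ : ∀ m → Even (2 + m) → Even m
  even-2+ m = ≡.trans (≡.sym (not-involutive (odd m)))

  even⇒double : ∀ m → Even m → Σ ℕ (λ j → m ≡ j + j)
  even⇒double zero          _  = 0 , ≡.refl
  even⇒double (suc zero)    ()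
  even⇒double (suc (suc m)) ev with even⇒double m (even-2+ m ev)
  ... | j , ≡.refl = suc j , ≡.cong suc (≡.sym (+-suc j j))

  odd⇒positive : ∀ {t} → odd t ≡ true → 0 < t
  odd⇒positive {suc t} _ = s≤s z≤n

  even-sum-odd-summand : ∀ s t → Even (s + t) → odd t ≡ true → Even (suc s)
  even-sum-odd-summand s t ev odd-t with odd s | ≡.trans (≡.sym (odd-+ s t)) ev
  ... | true  | _        = ≡.refl
  ... | false | odd-t≡ff = contradiction (≡.trans (≡.sym odd-t) odd-t≡ff) λ ()

open Parity

-- 2ⁿ ≠ 2(n − 1)² for even n ≥ 2, since the left side is 0 and the right side
-- is 2 modulo 4.  Without subtraction: 2ⁿ + 4n ≠ 2 + 2n².

module PowerVersusSquare where
  open Nat using (_+_; _*_; _^_)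

  *4≢2+*4 : ∀ a b → a * 4 ≢ 2 + b * 4
  *4≢2+*4 zero    b       ()
  *4≢2+*4 (suc a) zero    ()
  *4≢2+*4 (suc a) (suc b) eq =
    *4≢2+*4 a b (suc-injective (suc-injective (suc-injective (suc-injective eq))))

  pow≢twice-square : ∀ j → let n = 2 + (j + j) in 2 ^ n + 4 * n ≢ 2 + 2 * (n * n)
  pow≢twice-square j eq = *4≢2+*4 (2 ^ (j + j) + (2 + (j + j))) (2 + 4 * j + 2 * (j * j))
    (≡.trans (≡.sym (lhs-mod4 (2 ^ (j + j)) j)) (≡.trans eq (rhs-mod4 j)))
    where
    lhs-mod4 : ∀ p j → 2 * (2 * p) + 4 * (2 + (j + j)) ≡ (p + (2 + (j + j))) * 4
    lhs-mod4 = solve-∀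
    rhs-mod4 : ∀ j → 2 + 2 * ((2 + (j + j)) * (2 + (j + j))) ≡ 2 + (2 + 4 * j + 2 * (j * j)) * 4
    rhs-mod4 = solve-∀

open PowerVersusSquare

-- Eliminating b and c from  b + n·a = a,  c + n·b = b,  2·c = N·a  in any
-- commutative monoid (written additively) gives (N + 4n)·a = (2 + 2n²)·a,
-- the subtraction-free form of 2(1 − n)²·a = N·a.

module MultipleElimination {c ℓ} (M : CommutativeMonoid c ℓ) where
  open CommutativeMonoid M
  open Nat using (_+_; _*_)
  open import Algebra.Properties.CommutativeMonoid.Mult M
  open import Algebra.Solver.CommutativeMonoid M using (solve; _⊕_; _⊜_; id)
  open import Relation.Binary.Reasoning.Setoid setoid

  eliminate : ∀ n N {a b c} → b ∙ n × a ≈ a → c ∙ n × b ≈ b → 2 × c ≈ N × a →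
              (N + 4 * n) × a ≈ (2 + 2 * (n * n)) × a
  eliminate n N {a} {b} {c} b-eq c-eq 2c-eq = begin
    (N + 4 * n) × a                       ≈⟨ ×-homo-+ a N (4 * n) ⟩
    N × a ∙ (4 * n) × a                   ≈⟨ ∙-cong (sym 2c-eq) (sym (×-assocˡ a 4 n)) ⟩
    2 × c ∙ 4 × u                         ≈⟨ solve 2 (λ c u → (c ⊕ (c ⊕ id)) ⊕ (u ⊕ (u ⊕ (u ⊕ (u ⊕ id))))
                                                          ⊜ ((c ⊕ c) ⊕ (u ⊕ u)) ⊕ (u ⊕ u)) refl c u ⟩
    ((c ∙ c) ∙ (u ∙ u)) ∙ (u ∙ u)         ≈⟨ ∙-congˡ (∙-cong (sym nb-eq) (sym nb-eq)) ⟩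
    ((c ∙ c) ∙ (u ∙ u)) ∙ ((v ∙ w) ∙ (v ∙ w))
      ≈⟨ solve 4 (λ c u v w → ((c ⊕ c) ⊕ (u ⊕ u)) ⊕ ((v ⊕ w) ⊕ (v ⊕ w))
                               ⊜ ((c ⊕ v) ⊕ (c ⊕ v)) ⊕ ((u ⊕ u) ⊕ (w ⊕ w))) refl c u v w ⟩
    ((c ∙ v) ∙ (c ∙ v)) ∙ ((u ∙ u) ∙ (w ∙ w)) ≈⟨ ∙-congʳ (∙-cong c-eq c-eq) ⟩
    (b ∙ b) ∙ ((u ∙ u) ∙ (w ∙ w))
      ≈⟨ solve 3 (λ b u w → (b ⊕ b) ⊕ ((u ⊕ u) ⊕ (w ⊕ w)) ⊜ ((b ⊕ u) ⊕ (b ⊕ u)) ⊕ (w ⊕ w)) refl b u w ⟩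
    ((b ∙ u) ∙ (b ∙ u)) ∙ (w ∙ w)         ≈⟨ ∙-congʳ (∙-cong b-eq b-eq) ⟩
    (a ∙ a) ∙ (w ∙ w)
      ≈⟨ solve 2 (λ a w → (a ⊕ a) ⊕ (w ⊕ w) ⊜ (a ⊕ (a ⊕ id)) ⊕ (w ⊕ (w ⊕ id))) refl a w ⟩
    2 × a ∙ 2 × w                         ≈⟨ ∙-congˡ (×-assocˡ a 2 (n * n)) ⟩
    2 × a ∙ (2 * (n * n)) × a             ≈⟨ sym (×-homo-+ a 2 (2 * (n * n))) ⟩
    (2 + 2 * (n * n)) × a                 ∎
    where
    u v w : Carrier
    u = n × a
    v = n × b
    w = (n * n) × a
    -- n times the first equation: n·b + n²·a = n·a.
    nb-eq : v ∙ w ≈ u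
    nb-eq = trans (∙-congˡ (sym (×-assocˡ a n n))) (trans (sym (×-distrib-+ b u n)) (×-congʳ n b-eq))


module Numerals {c ℓ} (S : Semiring c ℓ) where
  open Semiring S
  open import Algebra.Definitions.RawSemiring (Semiring.rawSemiring S) using (_×_; _^_)
  open import Algebra.Properties.Semiring.Mult S using (×1-homo-*; ×-homo-1; ×-assoc-*)
  open import Algebra.Properties.Monoid.Mult +-monoid using (×-congʳ)

  ×1-* : ∀ k a → (k × 1#) * a ≈ k × a
  ×1-* k a = trans (×-assoc-* k 1# a) (×-congʳ k (*-identityˡ a))

  ×1-homo-^ : ∀ m n → (m × 1#) ^ n ≈ (m Nat.^ n) × 1#
  ×1-homo-^ m zero    = sym (×-homo-1 1#)
  ×1-homo-^ m (suc n) = trans (*-congˡ (×1-homo-^ m n)) (sym (×1-homo-* m (m Nat.^ n)))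

module Signs {c ℓ} (R : Ring c ℓ) where
  open Ring R
  open import Algebra.Definitions.RawSemiring (Semiring.rawSemiring semiring) using (_^_)
  open import Algebra.Properties.Ring R using (-1*x≈-x; -‿involutive)

  -1^ : ∀ n → (- 1#) ^ n ≈ (if odd n then - 1# else 1#)
  -1^ zero = refl
  -1^ (suc n) with odd n | -1^ n
  ... | true  | sign = trans (*-congˡ sign) (trans (-1*x≈-x (- 1#)) (-‿involutive 1#))
  ... | false | sign = trans (*-congˡ sign) (*-identityʳ (- 1#))

module CharacteristicZero {c ℓ} (K : Field c ℓ) (ch : CharZero K) where
  open Field K
  open import Algebra.Properties.Ring ring using (+-identityʳ-unique)
  open import Algebra.Properties.Monoid.Mult +-monoid using (×-congˡ; ×-homo-+)
  open Numerals semiring using (×1-*; ×1-homo-^)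
  open PowerSeries K using (Series; halfDouble)
  open import Relation.Binary.Reasoning.Setoid setoid

  -- (k + 1)·1 is invertible, so (k + 1)·a = 0 forces a = 0.
  multiple≈0 : ∀ k a → suc k × a ≈ 0# → a ≈ 0#
  multiple≈0 k a ka≈0 with inverse (suc k × 1#) (ch k)
  ... | y , k*y≈1 = begin
    a                        ≈⟨ sym (*-identityˡ a) ⟩
    1# * a                   ≈⟨ *-congʳ (trans (sym k*y≈1) (*-comm _ y)) ⟩
    (y * (suc k × 1#)) * a   ≈⟨ *-assoc y _ a ⟩
    y * ((suc k × 1#) * a)   ≈⟨ *-congˡ (trans (×1-* (suc k) a) ka≈0) ⟩
    y * 0#                   ≈⟨ zeroʳ y ⟩
    0#                       ∎

  -- If m < n then n·a = m·a + (n − m)·a, so m·a = n·a forces (n − m)·a = 0.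
  ×-cancel-< : ∀ {m n a} → m < n → m × a ≈ n × a → a ≈ 0#
  ×-cancel-< {m} {n} {a} m<n ma≈na with m≤n⇒∃[o]m+o≡n m<n
  ... | o , m+1+o≡n = multiple≈0 o a (+-identityʳ-unique (m × a) (suc o × a) (begin
    m × a + suc o × a    ≈⟨ sym (×-homo-+ a m (suc o)) ⟩
    (m Nat.+ suc o) × a  ≈⟨ ×-congˡ (≡.trans (+-suc m o) m+1+o≡n) ⟩
    n × a                ≈⟨ sym ma≈na ⟩
    m × a                ∎))

  ×-cancel : ∀ {m n a} → m ≢ n → m × a ≈ n × a → a ≈ 0#
  ×-cancel {m} {n} m≢n ma≈na with <-cmp m n
  ... | tri< m<n _ _ = ×-cancel-< m<n ma≈na
  ... | tri≈ _ m≡n _ = contradiction m≡n m≢n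
  ... | tri> _ _ n<m = ×-cancel-< n<m (sym ma≈na)

  -- The hypothesis 𝔗²f = f(2x)/2 is used in the form 2·(𝔗²f)ₙ = 2ⁿ·fₙ.
  double-halfDouble : ∀ (f : Series) n → 2 × halfDouble ch f n ≈ (2 Nat.^ n) × f n
  double-halfDouble f n = begin
    2 × (½ * (two ^ n * f n))      ≈⟨ sym (×1-* 2 _) ⟩
    two * (½ * (two ^ n * f n))    ≈⟨ sym (*-assoc two ½ _) ⟩
    (two * ½) * (two ^ n * f n)    ≈⟨ *-congʳ (proj₂ (inverse two (ch 1))) ⟩
    1# * (two ^ n * f n)           ≈⟨ *-identityˡ _ ⟩
    two ^ n * f n                  ≈⟨ *-congʳ (×1-homo-^ 2 n) ⟩
    ((2 Nat.^ n) × 1#) * f n       ≈⟨ ×1-* (2 Nat.^ n) (f n) ⟩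
    (2 Nat.^ n) × f n              ∎
    where
    two ½ : Carrier
    two = 2 × 1#
    ½ = proj₁ (inverse two (ch 1))

-- The quotient F / D is defined by qₙ = Fₙ − conv 0 (hist n), where
-- conv j (hist m) = Σ D_s·q_t over s + t = j + m, t < m.  Two ways of
-- evaluating such sums when most of their terms vanish.

module QuotientSums {c ℓ} (K : Field c ℓ) (F D : PowerSeries.Series K) where
  open Field K
  open PowerSeries.Quot K F D

  conv-vanishes : ∀ m j → (∀ s t → s Nat.+ t ≡ j Nat.+ m → t < m → D s * quot t ≈ 0#) →
                  conv j (hist m) ≈ 0#
  conv-vanishes zero    j _       = refl
  conv-vanishes (suc m) j terms≈0 = trans
    (+-cong (terms≈0 (suc j) m (≡.sym (+-suc j m)) (n<1+n m))
            (conv-vanishes m (suc j) λ s t s+t≡ t<m →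
               terms≈0 s t (≡.trans s+t≡ (≡.sym (+-suc j m))) (m<n⇒m<1+n t<m)))
    (+-identityʳ 0#)

  conv-leading : ∀ m j →
    (∀ s t → s Nat.+ t ≡ j Nat.+ suc (suc m) → 2 ≤ t → t < suc (suc m) → D s * quot t ≈ 0#) →
    conv j (hist (suc (suc m))) ≈ D (suc (j Nat.+ m)) * quot 1 + D (suc (suc (j Nat.+ m))) * quot 0
  conv-leading zero    j _ rewrite NatProp.+-identityʳ j = +-congˡ (+-identityʳ _)
  conv-leading (suc m) j terms≈0 rewrite +-suc j m = trans
    (+-cong (terms≈0 (suc j) (suc (suc m)) (≡.sym (+-suc j (suc (suc m)))) (s≤s (s≤s z≤n)) (n<1+n _))
            (conv-leading m (suc j) λ s t s+t≡ 2≤t t<m →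
               terms≈0 s t (≡.trans s+t≡ (≡.sym (+-suc j (suc (suc m))))) 2≤t (m<n⇒m<1+n t<m)))
    (+-identityˡ _)

module Transform {c ℓ} (K : Field c ℓ) where
  open Field K
  open PowerSeries K
  open import Algebra.Properties.Ring ring using (-0#≈0#; -1*x≈-x)
  open Numerals semiring using (×1-*)
  open Signs ring using (-1^)

  *-zeroʳ-≈ : ∀ {x y} → y ≈ 0# → x * y ≈ 0#
  *-zeroʳ-≈ {x} y≈0 = trans (*-congˡ y≈0) (zeroʳ x)

  *-zeroˡ-≈ : ∀ {x y} → x ≈ 0# → x * y ≈ 0#
  *-zeroˡ-≈ {y = y} x≈0 = trans (*-congʳ x≈0) (zeroˡ y)

  x-0≈x : ∀ x → x - 0# ≈ x
  x-0≈x x = trans (+-congˡ -0#≈0#) (+-identityʳ x)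

  x-y+y≈x : ∀ x y → (x - y) + y ≈ x
  x-y+y≈x x y = trans (+-assoc x (- y) y) (trans (+-congˡ (-‿inverseˡ y)) (+-identityʳ x))

  OddBelow : ℕ → Series → Set ℓ
  OddBelow n g = ∀ e → e < n → Even e → g e ≈ 0#

  OddBelow-suc : ∀ {n g} → OddBelow n g → (Even n → g n ≈ 0#) → OddBelow (suc n) g
  OddBelow-suc below top e e<1+n ev with m<1+n⇒m<n∨m≡n e<1+n
  ... | inj₁ e<n    = below e e<n ev
  ... | inj₂ ≡.refl = top ev

  odd-series : ∀ f → (∀ n → Even n → f n ≈ 0#) → negArg f ≋ negS f
  odd-series f even≈0 n with odd n in parity | -1^ n
  ... | true  | sign = trans (*-congʳ sign) (-1*x≈-x (f n))
  ... | false | sign = trans (*-congʳ sign) (trans (*-identityˡ (f n))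
                         (trans fn≈0 (sym (trans (-‿cong fn≈0) -0#≈0#))))
    where
    fn≈0 : f n ≈ 0#
    fn≈0 = even≈0 n parity

  module _ (g : Series) (g∈ : InX+X² g) where
    open Quot g (deriv g) using (conv; hist)
    open QuotientSums K g (deriv g)

    𝔗-constant : 𝔗 g 0 ≈ 0#
    𝔗-constant = trans (x-0≈x (g 0)) (proj₁ g∈)

    𝔗-linear : 𝔗 g 1 ≈ 1#
    𝔗-linear = trans (+-congˡ (-‿cong (trans (+-identityʳ _) (*-zeroʳ-≈ 𝔗-constant))))
                     (trans (x-0≈x (g 1)) (proj₂ g∈))

    𝔗-InX+X² : InX+X² (𝔗 g)
    𝔗-InX+X² = 𝔗-constant , 𝔗-linear

    deriv-vanishes : ∀ {n s} → OddBelow n g → suc s < n → Even (suc s) → deriv g s ≈ 0#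
    deriv-vanishes {s = s} oddG s+1<n ev =
      trans (sym (×1-* (suc s) (g (suc s)))) (*-zeroʳ-≈ (oddG (suc s) s+1<n ev))

    -- A term g'_s·(𝔗g)_t of even degree s + t vanishes: for even t since 𝔗g has
    -- no even terms below m, for odd t since then s + 1 is even.
    term-vanishes : ∀ {n m s t} → OddBelow n g → OddBelow m (𝔗 g) → Even (s Nat.+ t) → t < m →
                    (0 < t → suc s < n) → deriv g s * 𝔗 g t ≈ 0#
    term-vanishes {s = s} {t} oddG oddQ ev t<m s+1<n with odd t in parity
    ... | false = *-zeroʳ-≈ (oddQ t t<m parity)
    ... | true  = *-zeroˡ-≈ (deriv-vanishes oddG (s+1<n (odd⇒positive parity))
                                             (even-sum-odd-summand s t ev parity))

    𝔗-OddBelow : ∀ {n} → OddBelow n g → OddBelow n (𝔗 g)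
    𝔗-OddBelow {n} oddG = below n ≤-refl
      where
      below : ∀ k → k ≤ n → OddBelow k (𝔗 g)
      below zero    _   = λ _ ()
      below (suc k) k<n = OddBelow-suc oddQ λ ev →
        trans (+-cong (oddG k k<n ev) (-‿cong (conv-vanishes k 0 (terms ev)))) (x-0≈x 0#)
        where
        oddQ : OddBelow k (𝔗 g)
        oddQ = below k (<⇒≤ k<n)
        terms : Even k → ∀ s t → s Nat.+ t ≡ k → t < k → deriv g s * 𝔗 g t ≈ 0#
        terms ev s t s+t≡k t<k = term-vanishes oddG oddQ (≡.subst Even (≡.sym s+t≡k) ev) t<k
          λ 0<t → ≤-<-trans (≡.subst (suc s ≤_) s+t≡k (m<m+n s 0<t)) k<n

    𝔗-coefficient : ∀ {n} → 2 ≤ n → Even n → OddBelow n g → 𝔗 g n + n × g n ≈ g n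
    𝔗-coefficient {suc (suc m)} (s≤s (s≤s z≤n)) ev oddG =
      trans (+-congʳ (+-congˡ (-‿cong leading))) (x-y+y≈x (g n) _)
      where
      n : ℕ
      n = suc (suc m)
      terms : ∀ s t → s Nat.+ t ≡ n → 2 ≤ t → t < n → deriv g s * 𝔗 g t ≈ 0#
      terms s t s+t≡n 2≤t t<n = term-vanishes oddG (𝔗-OddBelow oddG) (≡.subst Even (≡.sym s+t≡n) ev) t<n
        λ _ → ≡.subst (suc (suc s) ≤_) s+t≡n (≡.subst (_≤ s Nat.+ t) (NatProp.+-comm s 2) (+-monoʳ-≤ s 2≤t))
      -- only g'_{n−1}·(𝔗g)₁ = n·gₙ survives in the sum defining (𝔗g)ₙ
      leading : conv 0 (hist n) ≈ n × g n
      leading = trans (conv-leading m 0 terms)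
        (trans (+-cong (trans (*-congˡ 𝔗-linear) (*-identityʳ _)) (*-zeroʳ-≈ 𝔗-constant)) (+-identityʳ _))

module EvenCoefficients {c ℓ} (K : Field c ℓ) (ch : CharZero K) where
  open Field K
  open PowerSeries K
  open Transform K
  open CharacteristicZero K ch using (×-cancel; double-halfDouble)
  open MultipleElimination +-commutativeMonoid using (eliminate)
  open import Algebra.Properties.Monoid.Mult +-monoid using (×-congʳ)

  module _ (f : Series) (f∈ : InX+X² f) (hyp : 𝔗 (𝔗 f) ≋ halfDouble ch f) where

    even-step : ∀ j → let n = 2 Nat.+ (j Nat.+ j) in Even n → OddBelow n f → f n ≈ 0#
    even-step j ev oddF = ×-cancel (pow≢twice-square j) (eliminate n (2 Nat.^ n) f-step g-step doubling)
      where
      n : ℕ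
      n = 2 Nat.+ (j Nat.+ j)
      n≥2 : 2 ≤ n
      n≥2 = s≤s (s≤s z≤n)
      f-step : 𝔗 f n + n × f n ≈ f n
      f-step = 𝔗-coefficient f f∈ n≥2 ev oddF
      g-step : 𝔗 (𝔗 f) n + n × 𝔗 f n ≈ 𝔗 f n
      g-step = 𝔗-coefficient (𝔗 f) (𝔗-InX+X² f f∈) n≥2 ev (𝔗-OddBelow f f∈ oddF)
      doubling : 2 × 𝔗 (𝔗 f) n ≈ (2 Nat.^ n) × f n
      doubling = trans (×-congʳ 2 (hyp n)) (double-halfDouble f n)

    even-coefficient : ∀ n → Even n → OddBelow n f → f n ≈ 0#
    even-coefficient zero          _  _    = proj₁ f∈
    even-coefficient (suc zero)    ()
    even-coefficient (suc (suc m)) ev oddF with even⇒double m (even-2+ m ev)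
    ... | j , ≡.refl = even-step j ev oddF

    odd-below : ∀ n → OddBelow n f
    odd-below zero    = λ _ ()
    odd-below (suc n) = OddBelow-suc (odd-below n) λ ev → even-coefficient n ev (odd-below n)

    even-coefficients-vanish : ∀ n → Even n → f n ≈ 0#
    even-coefficients-vanish n = odd-below (suc n) n (n<1+n n)

proposition1p7 : ∀ {c ℓ : Level} (K : Field c ℓ) (ch : CharZero K)
    (f : PowerSeries.Series K) →
    PowerSeries.InX+X² K f →
    PowerSeries._≋_ K (PowerSeries.𝔗 K (PowerSeries.𝔗 K f)) (PowerSeries.halfDouble K ch f) →
    PowerSeries._≋_ K (PowerSeries.negArg K f) (PowerSeries.negS K f)
proposition1p7 K ch f f∈ hyp =
  Transform.odd-series K f (EvenCoefficients.even-coefficients-vanish K ch f f∈ hyp)
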